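{- Let $k\ge 2$, let $H$ be a $k$-uniform partial cube-hypergraph, and let $e\in E(H)$. If $u$ and $v$ are vertices lying in different connected components of $H-F_e$, then every shortest $u,v$-path in $H$ contains exactly one edge from $F_e$.
   Context: A hypergraph $H=(V(H),E(H))$ has edges that are non-empty subsets of $V(H)$; it is $k$-uniform if every edge has exactly $k$ vertices. A $u,v$-path of length $s\ge1$ is a sequence $u_0=u,e_1,u_1,\dots,e_s,u_s=v$ of pairwise distinct vertices $u_i$ and pairwise distinct edges $e_i$ with $\{u_{i-1},u_i\}\subseteq e_i$; $d_H(u,v)$ is the length of a shortest $u,v$-path ($d_H(u,u)=0$). A subhypergraph $H'$ of $H$ is isometric if $d_{H'}(u,v)=d_H(u,v)$ for all $u,v\in V(H')$. For $k\ge2$, $n\ge1$, the $k$-uniform $n$-cube $\mathcal{Q}_k^n$ has vertex set $\{0,1,\dots,k-1\}^n$, and its edges are exactly the sets consisting of all $n$-tuples that agree on a fixed set of $n-1$ coordinates (with fixed values) while the remaining coordinate ranges over $\{0,\dots,k-1\}$. A $k$-uniform hypergraph is a partial cube-hypergraph if it is an isometric subhypergraph of some $\mathcal{Q}_k^n$. For an edge $e=\{a_1,\dots,a_k\}$ let $H(a_i,e)=\{z\in V(H): d_H(z,a_i)<d_H(z,a_j)\text{ for all } j\ne i\}$ and $H_e=\{H(a_1,e),\dots,H(a_k,e)\}$. The relation $\Theta$ on $E(H)$ is defined by $e\,\Theta\, e'$ iff $e'\cap A\neq\emptyset$ for every $A\in H_e$. $F_e=\{f\in E(H): e\,\Theta\,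 f\}$. For $F\subseteq E(H)$, $H-F$ is the hypergraph with vertex set $V(H)$ and edge set $E(H)\setminus F$. -}

module Defs where

open import Data.Nat using (ℕ; zero; suc; _≤_; _<_)
open import Data.Fin using (Fin; toℕ; fromℕ; inject₁)
import Data.Fin as Fin
open import Data.Vec using (Vec; lookup)
open import Data.Product using (Σ; _×_; _,_)
open import Data.Unit using (⊤; tt)
open import Relation.Binary.PropositionalEquality using (_≡_; _≢_)
open import Relation.Nullary using (¬_)
open import Function.Definitions using (Injective)

Vtx : ℕ → ℕ → Set
Vtx k n = Vec (Fin k) n

-- Edges of Q_k^n, in canonical form: the free coordinate `dir` and a vertex `base`
-- fixing the values of the other coordinates; the value of `base` at `dir`
-- is normalised to 0, so distinct records = distinct edges (as vertex sets, k ≥ 2).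
record QEdge (k n : ℕ) : Set where
  constructor qedge
  field
    dir  : Fin n
    base : Vec (Fin k) n
    norm : toℕ (lookup base dir) ≡ 0
open QEdge public

_∋_ : {k n : ℕ} → QEdge k n → Vtx k n → Set
e ∋ v = ∀ j → j ≢ dir e → lookup v j ≡ lookup (base e) j

record SubHypergraph (k n : ℕ) : Set₁ where
  field
    V   : Vtx k n → Set
    E   : QEdge k n → Set
    E⊆V : ∀ e v → E e → e ∋ v → V v
open SubHypergraph public

Q : (k n : ℕ) → SubHypergraph k n
Q k n = record { V = λ _ → ⊤ ; E = λ _ → ⊤ ; E⊆V = λ _ _ _ _ → tt }

_─_ : {k n : ℕ} → SubHypergraph k n → (QEdge k n → Set) → SubHypergraph k n
H ─ F = record { V = V H ; E = λ f → E H f × ¬ F f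
               ; E⊆V = λ e v ef ev → E⊆V H e v (Data.Product.proj₁ ef) ev }

-- A u,v-path of length s: vertices u_0..u_s, edges e_1..e_s (indexed from 0 here),
-- pairwise distinct, with {u_{i-1},u_i} ⊆ e_i.  (s = 0 gives the trivial path u = v.)
record Path {k n : ℕ} (G : SubHypergraph k n) (u v : Vtx k n) (s : ℕ) : Set where
  field
    verts    : Fin (suc s) → Vtx k n
    edges    : Fin s → QEdge k n
    start    : verts Fin.zero ≡ u
    finish   : verts (fromℕ s) ≡ v
    verts-in : ∀ i → V G (verts i)
    edges-in : ∀ i → E G (edges i)
    inc      : ∀ i → (edges i ∋ verts (inject₁ i)) × (edges i ∋ verts (Fin.suc i))
    verts-distinct : Injective _≡_ _≡_ verts
    edges-distinct : Injective _≡_ _≡_ edges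
open Path public

Dist : {k n : ℕ} → SubHypergraph k n → Vtx k n → Vtx k n → ℕ → Set
Dist G u v m = Path G u v m × (∀ s → Path G u v s → m ≤ s)

IsIsometric : {k n : ℕ} → SubHypergraph k n → Set
IsIsometric {k} {n} H = ∀ u v → V H u → V H v → ∀ m →
  (Dist H u v m → Dist (Q k n) u v m) × (Dist (Q k n) u v m → Dist H u v m)

Region : {k n : ℕ} → SubHypergraph k n → Vtx k n → QEdge k n → Vtx k n → Set
Region {k} {n} G a e z = V G z × Σ ℕ λ m → Dist G z a m ×
  (∀ b → e ∋ b → b ≢ a → ∀ m' → Dist G z b m' → m < m')

Θ : {k n : ℕ} → SubHypergraph k n → QEdge k n → QEdge k n → Set
Θ {k} {n} G e f = ∀ a → e ∋ a → Σ (Vtx k n) λ z → (f ∋ z) × Region G a e z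

F : {k n : ℕ} → SubHypergraph k n → QEdge k n → QEdge k n → Set
F G e f = E G f × Θ G e f

Connected : {k n : ℕ} → SubHypergraph k n → Vtx k n → Vtx k n → Set
Connected G u v = Σ ℕ λ s → Path G u v s

-- In an isometric subhypergraph H of the cube Q_k^n the distance is the Hamming distance.
-- Consequently a vertex z lies in H(a,e) exactly when z agrees with a in the free coordinate of e,
-- so (for k ≥ 2) F_e consists of the edges of H parallel to e. A shortest u,v-path cannot use
-- one direction twice, since along a walk the Hamming distance grows by at most one per step and
-- two steps in one coordinate contribute at most one to it; and it must use the direction of e,
-- for otherwise it would be a path in H - F_e.
module Submission where

open import Defs
open import Data.Nat using (ℕ; zero; suc; _+_; _≤_; _<_; z≤n; s≤s)
open import Data.Nat.Properties
  using (≤-trans; ≤-reflexive; ≤-antisym; <⇒≢; <⇒≱; n≤1+n; +-mono-≤; +-monoʳ-≤; +-suc; +-assoc; +-comm;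
         +-identityʳ; +-cancelʳ-≤; module ≤-Reasoning)
open import Data.Nat.Tactic.RingSolver using (solve-∀)
open import Data.Fin using (Fin; fromℕ; inject₁) renaming (zero to fzero; suc to fsuc)
open import Data.Fin.Properties using (any?; toℕ-injective; suc-injective; 0≢1+n; _≟_)
open import Data.Vec using (Vec; []; _∷_; lookup; _[_]≔_)
open import Data.Vec.Properties
  using (∷-injectiveˡ; ∷-injectiveʳ; lookup∘update; lookup∘update′; tabulate∘lookup; tabulate-cong)
open import Data.List using (List; []; _∷_; length; tabulate)
open import Data.List.Properties using (length-tabulate)
open import Data.Product using (Σ; _×_; _,_; proj₁; proj₂; ∃₂)
open import Data.Empty using (⊥-elim)
open import Data.Unit using (tt)
open import Function using (_∘_)
open import Relation.Nullary using (¬_; yes; no)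
open import Relation.Nullary.Decidable using (decidable-stable)
open import Relation.Binary.PropositionalEquality
  using (_≡_; _≢_; refl; sym; trans; cong; subst; subst₂; module ≡-Reasoning)

private
  variable
    k n s : ℕ

lookup-ext : {A : Set} {x y : Vec A n} → (∀ j → lookup x j ≡ lookup y j) → x ≡ y
lookup-ext {x = x} {y} x≗y = trans (sym (tabulate∘lookup x)) (trans (tabulate-cong x≗y) (tabulate∘lookup y))

AgreeOff : Fin n → Vtx k n → Vtx k n → Set
AgreeOff d x y = ∀ j → j ≢ d → lookup x j ≡ lookup y j

agreeOff-≢ : {d : Fin n} {x y : Vtx k n} → AgreeOff d x y → x ≢ y → lookup x d ≢ lookup y d
agreeOff-≢ {d = d} {x} {y} x~y x≢y xᵈ≡yᵈ = x≢y (lookup-ext agree)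
  where
  agree : ∀ j → lookup x j ≡ lookup y j
  agree j with j ≟ d
  ... | yes refl = xᵈ≡yᵈ
  ... | no j≢d   = x~y j j≢d

∋-agreeOff : (e : QEdge k n) {x y : Vtx k n} → e ∋ x → e ∋ y → AgreeOff (dir e) x y
∋-agreeOff e x∈e y∈e j j≢d = trans (x∈e j j≢d) (sym (y∈e j j≢d))

mismatch : Fin k → Fin k → ℕ
mismatch a c with a ≟ c
... | yes _ = 0
... | no _  = 1

mismatch-≡ : {a c : Fin k} → a ≡ c → mismatch a c ≡ 0
mismatch-≡ {a = a} {c} a≡c with a ≟ c
... | yes _   = refl
... | no a≢c  = ⊥-elim (a≢c a≡c)

mismatch-≢ : {a c : Fin k} → a ≢ c → mismatch a c ≡ 1
mismatch-≢ {a = a} {c} a≢c with a ≟ c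
... | yes a≡c = ⊥-elim (a≢c a≡c)
... | no _    = refl

mismatch≤1 : (a c : Fin k) → mismatch a c ≤ 1
mismatch≤1 a c with a ≟ c
... | yes _ = z≤n
... | no _  = s≤s z≤n

hamming : Vtx k n → Vtx k n → ℕ
hamming []      []      = 0
hamming (a ∷ x) (c ∷ z) = mismatch a c + hamming x z

hamming-exchange : (d : Fin n) (z x y : Vtx k n) → AgreeOff d x y →
  hamming z x + mismatch (lookup z d) (lookup y d) ≡ hamming z y + mismatch (lookup z d) (lookup x d)
hamming-exchange fzero (c ∷ z) (a ∷ x) (b ∷ y) x~y
  rewrite lookup-ext {x = x} {y} (λ j → x~y (fsuc j) λ ())
  = rotate (mismatch c a) (hamming z y) (mismatch c b)
  where
  rotate : ∀ p h q → p + h + q ≡ q + h + p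
  rotate = solve-∀
hamming-exchange (fsuc d) (c ∷ z) (a ∷ x) (b ∷ y) x~y rewrite x~y fzero λ () = begin
  mismatch c b + hamming z x + mismatch (lookup z d) (lookup y d)
    ≡⟨ +-assoc (mismatch c b) _ _ ⟩
  mismatch c b + (hamming z x + mismatch (lookup z d) (lookup y d))
    ≡⟨ cong (mismatch c b +_) (hamming-exchange d z x y λ j j≢d → x~y (fsuc j) (j≢d ∘ suc-injective)) ⟩
  mismatch c b + (hamming z y + mismatch (lookup z d) (lookup x d))
    ≡⟨ +-assoc (mismatch c b) _ _ ⟨
  mismatch c b + hamming z y + mismatch (lookup z d) (lookup x d) ∎
  where open ≡-Reasoning

hamming-≤-off : {d : Fin n} {z x y : Vtx k n} → AgreeOff d x y → lookup z d ≢ lookup x d →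
  hamming z y ≤ hamming z x
hamming-≤-off {d = d} {z} {x} {y} x~y zᵈ≢xᵈ = +-cancelʳ-≤ 1 _ _ (begin
  hamming z y + 1                                   ≡⟨ cong (hamming z y +_) (mismatch-≢ zᵈ≢xᵈ) ⟨
  hamming z y + mismatch (lookup z d) (lookup x d)  ≡⟨ hamming-exchange d z x y x~y ⟨
  hamming z x + mismatch (lookup z d) (lookup y d)  ≤⟨ +-monoʳ-≤ (hamming z x) (mismatch≤1 _ _) ⟩
  hamming z x + 1                                   ∎)
  where open ≤-Reasoning

hamming-<-on : {d : Fin n} {z x y : Vtx k n} → AgreeOff d x y →
  lookup z d ≡ lookup x d → lookup y d ≢ lookup x d → hamming z x < hamming z y
hamming-<-on {d = d} {z} {x} {y} x~y zᵈ≡xᵈ yᵈ≢xᵈ = ≤-reflexive (begin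
  suc (hamming z x)                                 ≡⟨ +-comm 1 _ ⟩
  hamming z x + 1                                   ≡⟨ cong (hamming z x +_) (mismatch-≢ λ zᵈ≡yᵈ → yᵈ≢xᵈ (trans (sym zᵈ≡yᵈ) zᵈ≡xᵈ)) ⟨
  hamming z x + mismatch (lookup z d) (lookup y d)  ≡⟨ hamming-exchange d z x y x~y ⟩
  hamming z y + mismatch (lookup z d) (lookup x d)  ≡⟨ cong (hamming z y +_) (mismatch-≡ zᵈ≡xᵈ) ⟩
  hamming z y + 0                                   ≡⟨ +-identityʳ _ ⟩
  hamming z y                                       ∎)
  where open ≡-Reasoning

data Walk {k : ℕ} : {n : ℕ} → Vtx k n → Vtx k n → List (Fin n) → Set where
  []  : {x : Vtx k n} → Walk x x []
  _∷_ : {x y z : Vtx k n} {d : Fin n} {ds : List (Fin n)} → AgreeOff d x y → Walk y z ds → Walk x z (d ∷ ds)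

occurrences : Fin n → List (Fin n) → ℕ
occurrences d []        = 0
occurrences d (d′ ∷ ds) with d ≟ d′
... | yes _ = suc (occurrences d ds)
... | no _  = occurrences d ds

tail-dirs : List (Fin (suc n)) → List (Fin n)
tail-dirs []           = []
tail-dirs (fzero ∷ ds) = tail-dirs ds
tail-dirs (fsuc d ∷ ds) = d ∷ tail-dirs ds

length-tail-dirs : (ds : List (Fin (suc n))) → length ds ≡ occurrences fzero ds + length (tail-dirs ds)
length-tail-dirs []            = refl
length-tail-dirs (fzero ∷ ds)  = cong suc (length-tail-dirs ds)
length-tail-dirs (fsuc d ∷ ds) = trans (cong suc (length-tail-dirs ds)) (sym (+-suc (occurrences fzero ds) _))

occurrences-tail-dirs : (d : Fin n) (ds : List (Fin (suc n))) →
  occurrences (fsuc d) ds ≡ occurrences d (tail-dirs ds)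
occurrences-tail-dirs d []             = refl
occurrences-tail-dirs d (fzero ∷ ds)   = occurrences-tail-dirs d ds
occurrences-tail-dirs d (fsuc d′ ∷ ds) with d ≟ d′ | fsuc d ≟ fsuc d′
... | yes _    | yes _    = cong suc (occurrences-tail-dirs d ds)
... | no _     | no _     = occurrences-tail-dirs d ds
... | yes refl | no d≢d′  = ⊥-elim (d≢d′ refl)
... | no d≢d′  | yes d≡d′ = ⊥-elim (d≢d′ (suc-injective d≡d′))

Walk-tail : {a c : Fin k} {x z : Vtx k n} {ds : List (Fin (suc n))} →
  Walk (a ∷ x) (c ∷ z) ds → Walk x z (tail-dirs ds)
Walk-tail [] = []
Walk-tail (_∷_ {y = b ∷ y} {d = fzero} x~y w) =
  subst (λ t → Walk t _ _) (sym (lookup-ext λ j → x~y (fsuc j) λ ())) (Walk-tail w)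
Walk-tail (_∷_ {y = b ∷ y} {d = fsuc d} x~y w) = (λ j j≢d → x~y (fsuc j) (j≢d ∘ suc-injective)) ∷ Walk-tail w

Walk-head : {a c : Fin k} {x z : Vtx k n} {ds : List (Fin (suc n))} →
  Walk (a ∷ x) (c ∷ z) ds → occurrences fzero ds ≡ 0 → a ≡ c
Walk-head [] _ = refl
Walk-head (_∷_ {y = b ∷ y} {d = fsuc d} x~y w) none = trans (x~y fzero λ ()) (Walk-head w none)

mismatch≤occurrences : {a c : Fin k} {x z : Vtx k n} {ds : List (Fin (suc n))} →
  Walk (a ∷ x) (c ∷ z) ds → mismatch a c ≤ occurrences fzero ds
mismatch≤occurrences {a = a} {c} {ds = ds} w with occurrences fzero ds in none
... | zero  = ≤-reflexive (mismatch-≡ (Walk-head w none))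
... | suc _ = ≤-trans (mismatch≤1 a c) (s≤s z≤n)

hamming≤length : {x z : Vtx k n} {ds : List (Fin n)} → Walk x z ds → hamming x z ≤ length ds
hamming≤length {x = []}    {[]}    w = z≤n
hamming≤length {x = a ∷ x} {c ∷ z} {ds} w =
  subst (mismatch a c + hamming x z ≤_) (sym (length-tail-dirs ds))
    (+-mono-≤ (mismatch≤occurrences w) (hamming≤length (Walk-tail w)))

-- Two steps in one coordinate can change it at most once.
hamming<length : {x z : Vtx k n} {ds : List (Fin n)} → Walk x z ds →
  (d : Fin n) → 2 ≤ occurrences d ds → hamming x z < length ds
hamming<length {x = a ∷ x} {c ∷ z} {ds} w fzero twice =
  subst (suc (mismatch a c + hamming x z) ≤_) (sym (length-tail-dirs ds))
    (+-mono-≤ (≤-trans (s≤s (mismatch≤1 a c)) twice) (hamming≤length (Walk-tail w)))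
hamming<length {x = a ∷ x} {c ∷ z} {ds} w (fsuc d) twice =
  subst₂ _≤_ (+-suc (mismatch a c) (hamming x z)) (sym (length-tail-dirs ds))
    (+-mono-≤ (mismatch≤occurrences w)
      (hamming<length (Walk-tail w) d (subst (2 ≤_) (occurrences-tail-dirs d ds) twice)))

module _ {G : SubHypergraph k n} where

  directions : {u v : Vtx k n} → Path G u v s → List (Fin n)
  directions P = tabulate (dir ∘ edges P)

  consecutive⇒Walk : (xs : Fin (suc s) → Vtx k n) (es : Fin s → QEdge k n) →
    (∀ i → (es i ∋ xs (inject₁ i)) × (es i ∋ xs (fsuc i))) →
    Walk (xs fzero) (xs (fromℕ s)) (tabulate (dir ∘ es))
  consecutive⇒Walk {s = zero}  xs es inc = []
  consecutive⇒Walk {s = suc s} xs es inc =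
    ∋-agreeOff (es fzero) {xs fzero} {xs (fsuc fzero)} (proj₁ (inc fzero)) (proj₂ (inc fzero))
    ∷ consecutive⇒Walk (xs ∘ fsuc) (es ∘ fsuc) (inc ∘ fsuc)

  Path⇒Walk : {u v : Vtx k n} (P : Path G u v s) → Walk u v (directions P)
  Path⇒Walk P = subst₂ (λ u v → Walk u v _) (start P) (finish P) (consecutive⇒Walk (verts P) (edges P) (inc P))

  hamming≤pathLength : {u v : Vtx k n} → Path G u v s → hamming u v ≤ s
  hamming≤pathLength P = subst (_ ≤_) (length-tabulate (dir ∘ edges P)) (hamming≤length (Path⇒Walk P))

occurrences-tabulate≥1 : (f : Fin s → Fin n) (i : Fin s) → 1 ≤ occurrences (f i) (tabulate f)
occurrences-tabulate≥1 f fzero with f fzero ≟ f fzero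
... | yes _  = s≤s z≤n
... | no ≢   = ⊥-elim (≢ refl)
occurrences-tabulate≥1 f (fsuc i) with f (fsuc i) ≟ f fzero
... | yes _  = s≤s z≤n
... | no _   = occurrences-tabulate≥1 (f ∘ fsuc) i

occurrences-tabulate≥2 : (f : Fin s → Fin n) {i j : Fin s} → i ≢ j → f i ≡ f j → 2 ≤ occurrences (f i) (tabulate f)
occurrences-tabulate≥2 f {fzero}  {fzero}  i≢j _ = ⊥-elim (i≢j refl)
occurrences-tabulate≥2 f {fzero}  {fsuc j} _ fi≡fj with f fzero ≟ f fzero
... | yes _ = s≤s (subst (λ d → 1 ≤ occurrences d (tabulate (f ∘ fsuc))) (sym fi≡fj) (occurrences-tabulate≥1 (f ∘ fsuc) j))
... | no ≢  = ⊥-elim (≢ refl)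
occurrences-tabulate≥2 f {fsuc i} {fzero}  _ fi≡fj with f (fsuc i) ≟ f fzero
... | yes _   = s≤s (occurrences-tabulate≥1 (f ∘ fsuc) i)
... | no fi≢f0 = ⊥-elim (fi≢f0 fi≡fj)
occurrences-tabulate≥2 f {fsuc i} {fsuc j} i≢j fi≡fj with f (fsuc i) ≟ f fzero
... | yes _ = ≤-trans (occurrences-tabulate≥2 (f ∘ fsuc) (i≢j ∘ cong fsuc) fi≡fj) (n≤1+n _)
... | no _  = occurrences-tabulate≥2 (f ∘ fsuc) (i≢j ∘ cong fsuc) fi≡fj

hamming<pathLength : {G : SubHypergraph k n} {u v : Vtx k n} (P : Path G u v s) {i j : Fin s} →
  i ≢ j → dir (edges P i) ≡ dir (edges P j) → hamming u v < s
hamming<pathLength P i≢j dirs≡ =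
  subst (_ <_) (length-tabulate (dir ∘ edges P))
    (hamming<length (Path⇒Walk P) _ (occurrences-tabulate≥2 (dir ∘ edges P) i≢j dirs≡))

Path-avoiding : {G : SubHypergraph k n} {u v : Vtx k n} (X : QEdge k n → Set) (P : Path G u v s) →
  (∀ i → ¬ X (edges P i)) → Path (G ─ X) u v s
Path-avoiding X P avoids = record
  { verts = verts P ; edges = edges P ; start = start P ; finish = finish P
  ; verts-in = verts-in P ; edges-in = λ i → edges-in P i , avoids i
  ; inc = inc P ; verts-distinct = verts-distinct P ; edges-distinct = edges-distinct P }

Path-prepend : {G : SubHypergraph k n} {w u v : Vtx k n} (f : QEdge k n) (P : Path G u v s) →
  V G w → E G f → f ∋ w → f ∋ u → (∀ i → verts P i ≢ w) → (∀ i → edges P i ≢ f) → Path G w v (suc s)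
Path-prepend {s = s} {G} {w} f P w∈G f∈G f∋w f∋u fresh-vertex fresh-edge = record
  { verts = xs ; edges = es ; start = refl ; finish = finish P
  ; verts-in = xs∈G ; edges-in = es∈G ; inc = incident
  ; verts-distinct = xs-injective ; edges-distinct = es-injective }
  where
  xs : Fin (suc (suc s)) → Vtx _ _
  xs fzero    = w
  xs (fsuc i) = verts P i
  es : Fin (suc s) → QEdge _ _
  es fzero    = f
  es (fsuc i) = edges P i
  xs∈G : ∀ i → V G (xs i)
  xs∈G fzero    = w∈G
  xs∈G (fsuc i) = verts-in P i
  es∈G : ∀ i → E G (es i)
  es∈G fzero    = f∈G
  es∈G (fsuc i) = edges-in P i
  incident : ∀ i → (es i ∋ xs (inject₁ i)) × (es i ∋ xs (fsuc i))
  incident fzero    = f∋w , subst (f ∋_) (sym (start P)) f∋u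
  incident (fsuc i) = inc P i
  xs-injective : ∀ {i j} → xs i ≡ xs j → i ≡ j
  xs-injective {fzero}  {fzero}  _  = refl
  xs-injective {fzero}  {fsuc j} eq = ⊥-elim (fresh-vertex j (sym eq))
  xs-injective {fsuc i} {fzero}  eq = ⊥-elim (fresh-vertex i eq)
  xs-injective {fsuc i} {fsuc j} eq = cong fsuc (verts-distinct P eq)
  es-injective : ∀ {i j} → es i ≡ es j → i ≡ j
  es-injective {fzero}  {fzero}  _  = refl
  es-injective {fzero}  {fsuc j} eq = ⊥-elim (fresh-edge j (sym eq))
  es-injective {fsuc i} {fzero}  eq = ⊥-elim (fresh-edge i eq)
  es-injective {fsuc i} {fsuc j} eq = cong fsuc (edges-distinct P eq)

liftEdge : Fin k → QEdge k n → QEdge k (suc n)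
liftEdge c (qedge d x norm) = qedge (fsuc d) (c ∷ x) norm

liftEdge-injective : {c : Fin k} {e f : QEdge k n} → liftEdge c e ≡ liftEdge c f → e ≡ f
liftEdge-injective {e = qedge _ _ _} {qedge _ _ _} refl = refl

liftEdge-∋ : {c : Fin k} (e : QEdge k n) {x : Vtx k n} → e ∋ x → liftEdge c e ∋ (c ∷ x)
liftEdge-∋ e x∈e fzero    _    = refl
liftEdge-∋ e x∈e (fsuc j) j≢d = x∈e j (j≢d ∘ cong fsuc)

Path-cons : (c : Fin k) {x z : Vtx k n} → Path (Q k n) x z s → Path (Q k (suc n)) (c ∷ x) (c ∷ z) s
Path-cons c P = record
  { verts = (c ∷_) ∘ verts P ; edges = liftEdge c ∘ edges P
  ; start = cong (c ∷_) (start P) ; finish = cong (c ∷_) (finish P)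
  ; verts-in = λ _ → tt ; edges-in = λ _ → tt
  ; inc = λ i → liftEdge-∋ (edges P i) (proj₁ (inc P i)) , liftEdge-∋ (edges P i) (proj₂ (inc P i))
  ; verts-distinct = verts-distinct P ∘ ∷-injectiveʳ
  ; edges-distinct = edges-distinct P ∘ liftEdge-injective }

hammingPath : (x z : Vtx (suc k) n) → Path (Q (suc k) n) x z (hamming x z)
hammingPath [] [] = record
  { verts = λ _ → [] ; edges = λ () ; start = refl ; finish = refl
  ; verts-in = λ _ → tt ; edges-in = λ () ; inc = λ ()
  ; verts-distinct = λ { {fzero} {fzero} _ → refl } ; edges-distinct = λ { {()} } }
hammingPath (a ∷ x) (c ∷ z) with a ≟ c
... | yes refl = Path-cons a (hammingPath x z)
... | no a≢c   = Path-prepend (qedge fzero (fzero ∷ x) refl) (Path-cons c (hammingPath x z)) tt tt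
  (λ { fzero j≢0 → ⊥-elim (j≢0 refl) ; (fsuc j) _ → refl })
  (λ { fzero j≢0 → ⊥-elim (j≢0 refl) ; (fsuc j) _ → refl })
  (λ _ → a≢c ∘ sym ∘ ∷-injectiveˡ)
  (λ _ → 0≢1+n ∘ sym ∘ cong dir)

dist-Q : (x z : Vtx (suc k) n) → Dist (Q (suc k) n) x z (hamming x z)
dist-Q x z = hammingPath x z , λ _ → hamming≤pathLength

module _ {H : SubHypergraph (suc k) n} (iso : IsIsometric H) where

  dist≡hamming : {x y : Vtx (suc k) n} {m : ℕ} → V H x → V H y → Dist H x y m → m ≡ hamming x y
  dist≡hamming {x} {y} {m} x∈H y∈H D with proj₁ (iso x y x∈H y∈H m) D
  ... | P , minimal = ≤-antisym (minimal _ (hammingPath x y)) (hamming≤pathLength P)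

  dist-hamming : {x y : Vtx (suc k) n} → V H x → V H y → Dist H x y (hamming x y)
  dist-hamming {x} {y} x∈H y∈H = proj₂ (iso x y x∈H y∈H _) (dist-Q x y)

  geodesic-dir-injective : {u v : Vtx (suc k) n} → V H u → V H v → (P : Path H u v s) →
    (∀ s′ → Path H u v s′ → s ≤ s′) → {i j : Fin s} → dir (edges P i) ≡ dir (edges P j) → i ≡ j
  geodesic-dir-injective u∈H v∈H P shortest {i} {j} dirs≡ = decidable-stable (i ≟ j) λ i≢j →
    <⇒≢ (hamming<pathLength P i≢j dirs≡) (sym (dist≡hamming u∈H v∈H (P , shortest)))

  Region-dir : {e : QEdge (suc k) n} {a b z : Vtx (suc k) n} → E H e → e ∋ a → e ∋ b → b ≢ a →
    Region H a e z → lookup z (dir e) ≡ lookup a (dir e)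
  Region-dir {e} {a} {b} {z} e∈H a∈e b∈e b≢a (z∈H , _ , dist-za , closer) =
    decidable-stable (lookup z (dir e) ≟ lookup a (dir e)) λ zᵈ≢aᵈ →
      <⇒≱ za<zb (hamming-≤-off {z = z} (∋-agreeOff e {a} {b} a∈e b∈e) zᵈ≢aᵈ)
    where
    za<zb : hamming z a < hamming z b
    za<zb = subst (_< hamming z b) (dist≡hamming z∈H (E⊆V H e a e∈H a∈e) dist-za)
              (closer b b∈e b≢a _ (dist-hamming z∈H (E⊆V H e b e∈H b∈e)))

  dir≡⇒Θ : {e f : QEdge (suc k) n} → E H e → E H f → dir f ≡ dir e → Θ H e f
  dir≡⇒Θ {e} {f} e∈H f∈H dirs≡ a a∈e = z , f∋z , z∈H , hamming z a , dist-hamming z∈H (E⊆V H e a e∈H a∈e) , closer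
    where
    d = dir e
    z : Vtx (suc k) n
    z = base f [ d ]≔ lookup a d
    f∋z : f ∋ z
    f∋z j j≢dir-f = lookup∘update′ (λ j≡d → j≢dir-f (trans j≡d (sym dirs≡))) (base f) (lookup a d)
    z∈H : V H z
    z∈H = E⊆V H f z f∈H f∋z
    closer : ∀ b → e ∋ b → b ≢ a → ∀ m → Dist H z b m → hamming z a < m
    closer b b∈e b≢a m D = subst (hamming z a <_) (sym (dist≡hamming z∈H (E⊆V H e b e∈H b∈e) D))
      (hamming-<-on {z = z} (∋-agreeOff e {a} {b} a∈e b∈e) (lookup∘update d (base f) (lookup a d))
        (agreeOff-≢ (∋-agreeOff e {b} {a} b∈e a∈e) b≢a))

edge-two-vertices : (e : QEdge (suc (suc k)) n) →
  ∃₂ λ a b → e ∋ a × e ∋ b × lookup a (dir e) ≢ lookup b (dir e)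
edge-two-vertices e =
  base e , base e [ dir e ]≔ fsuc fzero , (λ _ _ → refl) , (λ j j≢d → lookup∘update′ j≢d (base e) _) ,
  λ aᵈ≡bᵈ → 0≢1+n (trans (sym (toℕ-injective (norm e))) (trans aᵈ≡bᵈ (lookup∘update (dir e) (base e) _)))

-- Points of H(a,e) share the coordinate of a in the direction of e, whereas an edge not parallel
-- to e is constant in that coordinate; so f cannot meet the regions of two vertices of e.
Θ⇒dir≡ : {H : SubHypergraph (suc (suc k)) n} {e f : QEdge (suc (suc k)) n} → IsIsometric H →
  E H e → Θ H e f → dir f ≡ dir e
Θ⇒dir≡ {e = e} {f} iso e∈H Θef with edge-two-vertices e
... | a , b , a∈e , b∈e , aᵈ≢bᵈ = decidable-stable (dir f ≟ dir e) (aᵈ≢bᵈ ∘ through-f)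
  where
  open ≡-Reasoning
  d = dir e
  a≢b : a ≢ b
  a≢b = aᵈ≢bᵈ ∘ cong (λ x → lookup x d)
  witness : ∀ x → e ∋ x → Vtx _ _
  witness x x∈e = proj₁ (Θef x x∈e)
  witnessᵈ : ∀ x y (x∈e : e ∋ x) → e ∋ y → y ≢ x → lookup (witness x x∈e) d ≡ lookup x d
  witnessᵈ x y x∈e y∈e y≢x = Region-dir iso {a = x} {y} e∈H x∈e y∈e y≢x (proj₂ (proj₂ (Θef x x∈e)))
  through-f : dir f ≢ dir e → lookup a d ≡ lookup b d
  through-f dirs≢ = begin
    lookup a d                 ≡⟨ witnessᵈ a b a∈e b∈e (a≢b ∘ sym) ⟨
    lookup (witness a a∈e) d   ≡⟨ proj₁ (proj₂ (Θef a a∈e)) d (dirs≢ ∘ sym) ⟩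
    lookup (base f) d          ≡⟨ proj₁ (proj₂ (Θef b b∈e)) d (dirs≢ ∘ sym) ⟨
    lookup (witness b b∈e) d   ≡⟨ witnessᵈ b a b∈e a∈e a≢b ⟩
    lookup b d                 ∎

proposition3p2 : (k n : ℕ) → 2 ≤ k → 1 ≤ n → (H : SubHypergraph k n) → IsIsometric H →
    (e : QEdge k n) → E H e → (u v : Vtx k n) → V H u → V H v →
    ¬ Connected (H ─ F H e) u v →
    (s : ℕ) (P : Path H u v s) → (∀ s' → Path H u v s' → s ≤ s') →
    Σ (Fin s) λ i → F H e (edges P i) × (∀ j → F H e (edges P j) → j ≡ i)
proposition3p2 zero          _ () _ _ _ _ _ _ _ _ _ _ _ _ _
proposition3p2 (suc zero)    _ (s≤s ()) _ _ _ _ _ _ _ _ _ _ _ _ _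
proposition3p2 (suc (suc k)) n _ _ H iso e e∈H u v u∈H v∈H disconnected s P shortest
  with any? (λ i → dir (edges P i) ≟ dir e)
... | no no-parallel =
  ⊥-elim (disconnected (s , Path-avoiding (F H e) P λ i (_ , Θeᵢ) → no-parallel (i , Θ⇒dir≡ {f = edges P i} iso e∈H Θeᵢ)))
... | yes (i , parallel) = i , (edges-in P i , dir≡⇒Θ iso {f = edges P i} e∈H (edges-in P i) parallel) , unique
  where
  unique : ∀ j → F H e (edges P j) → j ≡ i
  unique j (_ , Θeⱼ) = geodesic-dir-injective iso u∈H v∈H P shortest (trans (Θ⇒dir≡ {f = edges P j} iso e∈H Θeⱼ) (sym parallel))
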